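{- For every $n\ge 0$, $$T_n(x,s,q)=\sum_{k=0}^{\lfloor n/2\rfloor}q^{\binom{n-2k}{2}}\begin{bmatrix} n\\ 2k\end{bmatrix}x^{n-2k}\prod_{j=0}^{k-1}(x^2+q^{2j+1}s)$$ and $$U_n(x,s,q)=\sum_{k=0}^{\lfloor n/2\rfloor}q^{\binom{n-2k}{2}}\begin{bmatrix} n+1\\ 2k+1\end{bmatrix}x^{n-2k}\prod_{j=0}^{k-1}(x^2+q^{2j+1}s).$$
   Context: Let $q$ be a real number with $q\neq -1$. Let $[m]=1+q+\dots+q^{m-1}$, $[m]!=[1]\cdots[m]$, $\begin{bmatrix} m\\ j\end{bmatrix}=\frac{[m]!}{[j]![m-j]!}$ for $0\le j\le m$. $T_0(x,s,q)=1$, $T_1(x,s,q)=x$, $T_n(x,s,q)=(1+q^{n-1})xT_{n-1}(x,s,q)+q^{n-1}sT_{n-2}(x,s,q)$ for $n\ge2$; $U_{ -1}(x,s,q)=0$, $U_0(x,s,q)=1$, $U_n(x,s,q)=(1+q^{n})xU_{n-1}(x,s,q)+q^{n-1}sU_{n-2}(x,s,q)$ for $n\ge 1$. Empty products equal $1$. -}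

module Defs where

open import Level using (Level; _⊔_) renaming (suc to lsuc)
open import Data.Nat as ℕ using (ℕ; zero; suc; _∸_)
open import Data.Nat.DivMod using (_/_)
open import Data.Nat.Combinatorics using (_C_)
open import Relation.Nullary using (¬_)
open import Relation.Binary.Core using (Rel)
open import Relation.Binary.Structures using (IsStrictTotalOrder)
open import Algebra.Bundles using (CommutativeRing)

-- The real numbers (not available in agda-stdlib) are
-- an instance; the theorem is stated for every ordered field.
-- The multiplicative inverse is a total function; its value at 0 is
-- unconstrained (it is only specified on nonzero elements).
record OrderedField (c ℓ₁ ℓ₂ : Level) : Set (lsuc (c ⊔ ℓ₁ ⊔ ℓ₂)) where
  field
    commutativeRing : CommutativeRing c ℓ₁
  open CommutativeRing commutativeRing public
  field
    _<_                : Rel Carrier ℓ₂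
    isStrictTotalOrder : IsStrictTotalOrder _≈_ _<_
    +-mono-<           : ∀ {a b} d → a < b → (a + d) < (b + d)
    *-pos              : ∀ {a b} → 0# < a → 0# < b → 0# < (a * b)
    0≉1                : ¬ (0# ≈ 1#)
    _⁻¹                : Carrier → Carrier
    ⁻¹-inverse         : ∀ a → ¬ (a ≈ 0#) → (a * (a ⁻¹)) ≈ 1#

module QDefs {c ℓ₁ ℓ₂} (F : OrderedField c ℓ₁ ℓ₂) where
  open OrderedField F hiding (zero)

  pow : Carrier → ℕ → Carrier
  pow a zero    = 1#
  pow a (suc n) = a * pow a n

  sumTo : (ℕ → Carrier) → ℕ → Carrier
  sumTo f zero    = f zero
  sumTo f (suc m) = sumTo f m + f (suc m)

  prodBelow : (ℕ → Carrier) → ℕ → Carrier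
  prodBelow f zero    = 1#
  prodBelow f (suc k) = prodBelow f k * f k

  qint : Carrier → ℕ → Carrier
  qint q zero    = 0#
  qint q (suc m) = qint q m + pow q m

  qfact : Carrier → ℕ → Carrier
  qfact q zero    = 1#
  qfact q (suc m) = qfact q m * qint q (suc m)

  -- q-binomial [m choose j] = [m]! / ([j]! [m-j]!)  (used for 0 ≤ j ≤ m)
  qbinom : Carrier → ℕ → ℕ → Carrier
  qbinom q m j = qfact q m * ((qfact q j * qfact q (m ∸ j)) ⁻¹)

  T : Carrier → Carrier → Carrier → ℕ → Carrier
  T x s q zero          = 1#
  T x s q (suc zero)    = x
  T x s q (suc (suc n)) =
    ((1# + pow q (suc n)) * x) * T x s q (suc n) + (pow q (suc n) * s) * T x s q n

  -- U_n for n ≥ 0 (U_{-1} = 0 is inlined in the n = 1 case)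
  U : Carrier → Carrier → Carrier → ℕ → Carrier
  U x s q zero          = 1#
  U x s q (suc zero)    = ((1# + pow q 1) * x) * 1# + (pow q 0 * s) * 0#
  U x s q (suc (suc n)) =
    ((1# + pow q (suc (suc n))) * x) * U x s q (suc n) + (pow q (suc n) * s) * U x s q n

  P : Carrier → Carrier → Carrier → ℕ → Carrier
  P x s q k = prodBelow (λ j → pow x 2 + pow q (suc (2 ℕ.* j)) * s) k

  T-rhs : Carrier → Carrier → Carrier → ℕ → Carrier
  T-rhs x s q n = sumTo (λ k → pow q ((n ∸ 2 ℕ.* k) C 2) * qbinom q n (2 ℕ.* k)
                                 * pow x (n ∸ 2 ℕ.* k) * P x s q k) (n / 2)

  U-rhs : Carrier → Carrier → Carrier → ℕ → Carrier
  U-rhs x s q n = sumTo (λ k → pow q ((n ∸ 2 ℕ.* k) C 2) * qbinom q (suc n) (suc (2 ℕ.* k))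
                                 * pow x (n ∸ 2 ℕ.* k) * P x s q k) (n / 2)

module Submission where

-- Write both sides in the basis xⁱ Pₖ with i + 2k = n, where Pₖ = ∏_{j<k} (x² + q^(2j+1) s).
-- The coefficient of xⁱ Pₖ is q^C(i,2) [i+e+2k choose e+2k], with e = 0 for T and e = 1 for U.
-- Because q^(n+1) s xⁱ Pₖ = qⁱ (xⁱ Pₖ₊₁ - xⁱ⁺² Pₖ) when i + 2k = n, these sums satisfy the
-- recurrences of T and U as soon as the coefficients satisfy a three-term identity, which
-- follows from the two q-Pascal rules. The q-binomials of the statement are quotients of
-- q-factorials; they agree with the Gaussian coefficients defined by the Pascal rule because
-- for q ≠ -1 in an ordered field every [m] with m ≥ 1 is nonzero.

open import Defs
open import Level using (Level)
open import Data.Nat as ℕ using (ℕ; zero; suc; _∸_; z≤n; s≤s)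
import Data.Nat.Properties as ℕ
open import Data.Nat.Combinatorics using (_C_; nCk+nC[k+1]≡[n+1]C[k+1]; nC1≡n)
open import Data.Nat.DivMod using (_/_; m/n≡1+[m∸n]/n)
open import Data.Nat.Tactic.RingSolver using (solve-∀)
open import Data.Product using (_×_; _,_; proj₁)
open import Data.Sum using (inj₁; inj₂)
open import Data.Empty using (⊥-elim)
open import Relation.Nullary using (¬_)
open import Relation.Binary.Definitions using (tri<; tri≈; tri>)
open import Relation.Binary.Structures using (IsStrictTotalOrder)
open import Relation.Binary.PropositionalEquality as ≡ using (_≡_)

[1+n]C2≡nC2+n : ∀ n → suc n C 2 ≡ n C 2 ℕ.+ n
[1+n]C2≡nC2+n n = ≡.trans (≡.sym (nCk+nC[k+1]≡[n+1]C[k+1] n 1))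
                          (≡.trans (≡.cong (ℕ._+ n C 2) (nC1≡n n)) (ℕ.+-comm n (n C 2)))

[2+n]/2≡1+n/2 : ∀ n → (2 ℕ.+ n) / 2 ≡ suc (n / 2)
[2+n]/2≡1+n/2 n = m/n≡1+[m∸n]/n {2 ℕ.+ n} (s≤s (s≤s z≤n))

m+2[1+n]≡2+[m+2n] : ∀ m n → m ℕ.+ 2 ℕ.* suc n ≡ 2 ℕ.+ (m ℕ.+ 2 ℕ.* n)
m+2[1+n]≡2+[m+2n] = solve-∀

m+[1+n+o]≡[m+o]+[1+n] : ∀ m n o → m ℕ.+ suc (n ℕ.+ o) ≡ (m ℕ.+ o) ℕ.+ suc n
m+[1+n+o]≡[m+o]+[1+n] = solve-∀

module _ {c ℓ₁ ℓ₂} (F : OrderedField c ℓ₁ ℓ₂) where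
  open OrderedField F hiding (zero)
  open QDefs F
  open import Algebra.Definitions _≈_ using (AlmostRightCancellative)
  open import Algebra.Properties.Ring ring using (-‿distribˡ-*; -‿distribʳ-*)
  open import Algebra.Properties.Group +-group using (⁻¹-involutive; ∙-cancelʳ; inverseʳ-unique)
  open import Algebra.Solver.Ring.NaturalCoefficients.Default commutativeSemiring
  open import Relation.Binary.Construct.StrictToNonStrict _≈_ _<_ using (_≤_)
  open import Relation.Binary.Reasoning.Setoid setoid
  private module STO = IsStrictTotalOrder isStrictTotalOrder

  *-cancelʳ-≉0 : AlmostRightCancellative 0# _*_
  *-cancelʳ-≉0 d a b d≉0 ad≈bd = begin
    a                ≈⟨ *-identityʳ a ⟨
    a * 1#           ≈⟨ *-congˡ (⁻¹-inverse d d≉0) ⟨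
    a * (d * d ⁻¹)   ≈⟨ *-assoc a d (d ⁻¹) ⟨
    (a * d) * d ⁻¹   ≈⟨ *-congʳ ad≈bd ⟩
    (b * d) * d ⁻¹   ≈⟨ *-assoc b d (d ⁻¹) ⟩
    b * (d * d ⁻¹)   ≈⟨ *-congˡ (⁻¹-inverse d d≉0) ⟩
    b * 1#           ≈⟨ *-identityʳ b ⟩
    b                ∎

  *-≉0 : ∀ {a b} → a ≉ 0# → b ≉ 0# → a * b ≉ 0#
  *-≉0 {a} {b} a≉0 b≉0 ab≈0 =
    b≉0 (*-cancelʳ-≉0 a b 0# a≉0 (trans (*-comm b a) (trans ab≈0 (sym (zeroˡ a)))))

  -x*-y≈x*y : ∀ a b → (- a) * (- b) ≈ a * b
  -x*-y≈x*y a b = begin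
    (- a) * (- b)   ≈⟨ -‿distribˡ-* a (- b) ⟨
    - (a * - b)     ≈⟨ -‿cong (-‿distribʳ-* a b) ⟨
    - (- (a * b))   ≈⟨ ⁻¹-involutive (a * b) ⟩
    a * b           ∎

  <-resp-≈ : ∀ {a a′ b b′} → a ≈ a′ → b ≈ b′ → a < b → a′ < b′
  <-resp-≈ a≈a′ b≈b′ a<b = STO.<-respˡ-≈ a≈a′ (STO.<-respʳ-≈ b≈b′ a<b)

  x<0⇒0<-x : ∀ {a} → a < 0# → 0# < (- a)
  x<0⇒0<-x {a} a<0 = <-resp-≈ (-‿inverseʳ a) (+-identityˡ (- a)) (+-mono-< (- a) a<0)

  x<0∧y<0⇒0<x*y : ∀ {a b} → a < 0# → b < 0# → 0# < (a * b)
  x<0∧y<0⇒0<x*y {a} {b} a<0 b<0 =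
    <-resp-≈ refl (-x*-y≈x*y a b) (*-pos (x<0⇒0<-x a<0) (x<0⇒0<-x b<0))

  0<1 : 0# < 1#
  0<1 with STO.compare 0# 1#
  ... | tri< 0<1 _ _ = 0<1
  ... | tri≈ _ 0≈1 _ = ⊥-elim (0≉1 0≈1)
  ... | tri> _ _ 1<0 = ⊥-elim (STO.irrefl refl (STO.trans 1<0 0<1*1))
    where
      0<1*1 : 0# < 1#
      0<1*1 = <-resp-≈ refl (*-identityˡ 1#) (x<0∧y<0⇒0<x*y 1<0 1<0)

  0≤x*x : ∀ a → 0# ≤ a * a
  0≤x*x a with STO.compare 0# a
  ... | tri< 0<a _ _ = inj₁ (*-pos 0<a 0<a)
  ... | tri≈ _ 0≈a _ = inj₂ (trans (sym (zeroˡ a)) (*-congʳ 0≈a))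
  ... | tri> _ _ a<0 = inj₁ (x<0∧y<0⇒0<x*y a<0 a<0)

  0<x∧0≤y⇒0<x+y : ∀ {a b} → 0# < a → 0# ≤ b → 0# < (a + b)
  0<x∧0≤y⇒0<x+y {a} {b} 0<a (inj₁ 0<b) =
    STO.trans (<-resp-≈ refl (sym (+-identityˡ b)) 0<b) (+-mono-< b 0<a)
  0<x∧0≤y⇒0<x+y {a} {b} 0<a (inj₂ 0≈b) =
    <-resp-≈ refl (trans (sym (+-identityʳ a)) (+-congˡ 0≈b)) 0<a

  0≤x∧0<y⇒0≤x*y : ∀ {a b} → 0# ≤ a → 0# < b → 0# ≤ a * b
  0≤x∧0<y⇒0≤x*y (inj₁ 0<a) 0<b = inj₁ (*-pos 0<a 0<b)
  0≤x∧0<y⇒0≤x*y {a} {b} (inj₂ 0≈a) 0<b = inj₂ (trans (sym (zeroˡ b)) (*-congʳ 0≈a))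

  0<x⇒x≉0 : ∀ {a} → 0# < a → a ≉ 0#
  0<x⇒x≉0 0<a a≈0 = STO.irrefl (sym a≈0) 0<a

  pow-+ : ∀ a m n → pow a (m ℕ.+ n) ≈ pow a m * pow a n
  pow-+ a zero    n = sym (*-identityˡ _)
  pow-+ a (suc m) n = trans (*-congˡ (pow-+ a m n)) (sym (*-assoc _ _ _))

  pow-[1+n]C2 : ∀ a n → pow a (suc n C 2) ≈ pow a (n C 2) * pow a n
  pow-[1+n]C2 a n = trans (reflexive (≡.cong (pow a) ([1+n]C2≡nC2+n n))) (pow-+ a (n C 2) n)

  shift : (ℕ → Carrier) → ℕ → Carrier
  shift f zero    = 0#
  shift f (suc n) = f n

  shift-*ˡ : ∀ d f n → shift (λ m → d * f m) n ≈ d * shift f n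
  shift-*ˡ d f zero    = sym (zeroʳ d)
  shift-*ˡ d f (suc n) = refl

  shift-even : ∀ {e} → e ℕ.≤ 1 → ∀ f k →
    shift (λ l → f (e ℕ.+ 2 ℕ.* l)) k ≡ shift (shift f) (e ℕ.+ 2 ℕ.* k)
  shift-even z≤n       f zero    = ≡.refl
  shift-even (s≤s z≤n) f zero    = ≡.refl
  shift-even {e} _     f (suc k) = ≡.cong (shift (shift f)) (≡.sym (m+2[1+n]≡2+[m+2n] e k))

  module _ (q : Carrier) where

    qint-suc : ∀ n → qint q (suc n) ≈ 1# + q * qint q n
    qint-suc zero    = trans (+-identityˡ 1#) (sym (trans (+-congˡ (zeroʳ q)) (+-identityʳ 1#)))
    qint-suc (suc n) = begin
      qint q (suc n) + q * pow q n       ≈⟨ +-congʳ (qint-suc n) ⟩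
      (1# + q * qint q n) + q * pow q n
        ≈⟨ solve 4 (λ o a b c → (o :+ a :* b) :+ a :* c := o :+ a :* (b :+ c)) refl 1# q (qint q n) (pow q n) ⟩
      1# + q * qint q (suc n)            ∎

    qint-+ : ∀ m n → qint q (m ℕ.+ n) ≈ qint q m + pow q m * qint q n
    qint-+ zero    n = sym (trans (+-identityˡ _) (*-identityˡ _))
    qint-+ (suc m) n = begin
      qint q (m ℕ.+ n) + pow q (m ℕ.+ n)           ≈⟨ +-cong (qint-+ m n) (pow-+ q m n) ⟩
      (qint q m + pow q m * qint q n) + pow q m * pow q n
        ≈⟨ solve 4 (λ A Q B QB → (A :+ Q :* B) :+ Q :* QB := A :+ Q :* (B :+ QB)) refl
                   (qint q m) (pow q m) (qint q n) (pow q n) ⟩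
      qint q m + pow q m * qint q (suc n)          ≈⟨ +-congˡ (*-congˡ (qint-suc n)) ⟩
      qint q m + pow q m * (1# + q * qint q n)
        ≈⟨ solve 4 (λ A Q B qq → A :+ Q :* (con 1 :+ qq :* B) := (A :+ Q) :+ (qq :* Q) :* B) refl
                   (qint q m) (pow q m) (qint q n) q ⟩
      qint q (suc m) + pow q (suc m) * qint q n    ∎

    [2+n]≈[2]+q²[n] : ∀ n → qint q (2 ℕ.+ n) ≈ (1# + q) + (q * q) * qint q n
    [2+n]≈[2]+q²[n] n = begin
      qint q (2 ℕ.+ n)                  ≈⟨ qint-suc (suc n) ⟩
      1# + q * qint q (suc n)           ≈⟨ +-congˡ (*-congˡ (qint-suc n)) ⟩
      1# + q * (1# + q * qint q n)
        ≈⟨ solve 2 (λ a b → con 1 :+ a :* (con 1 :+ a :* b) := (con 1 :+ a) :+ (a :* a) :* b) refl q (qint q n) ⟩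
      (1# + q) + (q * q) * qint q n     ∎

    [2+n]≈[n]+qⁿ[2] : ∀ n → qint q (2 ℕ.+ n) ≈ qint q n + pow q n * (1# + q)
    [2+n]≈[n]+qⁿ[2] n =
      solve 3 (λ a b c → (b :+ c) :+ a :* c := b :+ c :* (con 1 :+ a)) refl q (qint q n) (pow q n)

    0<1+q⇒0<[1+n] : 0# < (1# + q) → ∀ n → 0# < qint q (suc n)
    0<1+q⇒0<[1+n] 0<1+q zero = <-resp-≈ refl (sym (+-identityˡ 1#)) 0<1
    0<1+q⇒0<[1+n] 0<1+q (suc zero) =
      <-resp-≈ refl (solve 1 (λ a → con 1 :+ a := (con 0 :+ con 1) :+ a :* con 1) refl q) 0<1+q
    0<1+q⇒0<[1+n] 0<1+q (suc (suc n)) =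
      <-resp-≈ refl (sym ([2+n]≈[2]+q²[n] (suc n)))
        (0<x∧0≤y⇒0<x+y 0<1+q (0≤x∧0<y⇒0≤x*y (0≤x*x q) (0<1+q⇒0<[1+n] 0<1+q n)))

    1+q<0⇒q<0 : (1# + q) < 0# → q < 0#
    1+q<0⇒q<0 1+q<0 = STO.trans q<-1 -1<0
      where
        1+q-1≈q : (1# + q) + - 1# ≈ q
        1+q-1≈q = begin
          (1# + q) + - 1#   ≈⟨ +-congʳ (+-comm 1# q) ⟩
          (q + 1#) + - 1#   ≈⟨ +-assoc q 1# (- 1#) ⟩
          q + (1# + - 1#)   ≈⟨ +-congˡ (-‿inverseʳ 1#) ⟩
          q + 0#            ≈⟨ +-identityʳ q ⟩
          q                 ∎
        q<-1 : q < (- 1#)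
        q<-1 = <-resp-≈ 1+q-1≈q (+-identityˡ (- 1#)) (+-mono-< (- 1#) 1+q<0)
        -1<0 : (- 1#) < 0#
        -1<0 = <-resp-≈ (+-identityˡ (- 1#)) (-‿inverseʳ 1#) (+-mono-< (- 1#) 0<1)

    -- For q < -1 the sign of [1+n] alternates like that of q²⁺ⁿ.
    1+q<0⇒0<[1+n]q²⁺ⁿ : (1# + q) < 0# → ∀ n → 0# < (qint q (suc n) * pow q (2 ℕ.+ n))
    1+q<0⇒0<[1+n]q²⁺ⁿ 1+q<0 zero =
      <-resp-≈ refl (solve 1 (λ a → a :* a := (con 0 :+ con 1) :* (a :* (a :* con 1))) refl q)
        (x<0∧y<0⇒0<x*y (1+q<0⇒q<0 1+q<0) (1+q<0⇒q<0 1+q<0))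
    1+q<0⇒0<[1+n]q²⁺ⁿ 1+q<0 (suc zero) =
      <-resp-≈ refl
        (solve 1 (λ a → ((con 1 :+ a) :* a) :* (a :* a)
                      := ((con 0 :+ con 1) :+ a :* con 1) :* (a :* (a :* (a :* con 1)))) refl q)
        (*-pos (x<0∧y<0⇒0<x*y 1+q<0 (1+q<0⇒q<0 1+q<0))
               (x<0∧y<0⇒0<x*y (1+q<0⇒q<0 1+q<0) (1+q<0⇒q<0 1+q<0)))
    1+q<0⇒0<[1+n]q²⁺ⁿ 1+q<0 (suc (suc n)) =
      <-resp-≈ refl (sym expand)
        (0<x∧0≤y⇒0<x+y (*-pos (1+q<0⇒0<[1+n]q²⁺ⁿ 1+q<0 n) (x<0∧y<0⇒0<x*y q<0 q<0))
                       (0≤x∧0<y⇒0≤x*y (0≤x*x _) (x<0∧y<0⇒0<x*y 1+q<0 q<0)))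
      where
        q<0 : q < 0#
        q<0 = 1+q<0⇒q<0 1+q<0
        expand : qint q (3 ℕ.+ n) * pow q (4 ℕ.+ n)
               ≈ (qint q (suc n) * pow q (2 ℕ.+ n)) * (q * q)
                 + (pow q (2 ℕ.+ n) * pow q (2 ℕ.+ n)) * ((1# + q) * q)
        expand = begin
          qint q (3 ℕ.+ n) * pow q (4 ℕ.+ n)
            ≈⟨ *-congʳ ([2+n]≈[n]+qⁿ[2] (suc n)) ⟩
          (qint q (suc n) + pow q (suc n) * (1# + q)) * pow q (4 ℕ.+ n)
            ≈⟨ solve 3 (λ a b c → (b :+ c :* (con 1 :+ a)) :* (a :* (a :* (a :* c)))
                                := (b :* (a :* c)) :* (a :* a) :+ ((a :* c) :* (a :* c)) :* ((con 1 :+ a) :* a))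
                       refl q (qint q (suc n)) (pow q (suc n)) ⟩
          (qint q (suc n) * pow q (2 ℕ.+ n)) * (q * q)
            + (pow q (2 ℕ.+ n) * pow q (2 ℕ.+ n)) * ((1# + q) * q)  ∎

    qint-≉0 : q ≉ - 1# → ∀ n → qint q (suc n) ≉ 0#
    qint-≉0 q≉-1 n with STO.compare 0# (1# + q)
    ... | tri< 0<1+q _ _ = 0<x⇒x≉0 (0<1+q⇒0<[1+n] 0<1+q n)
    ... | tri≈ _ 0≈1+q _ = ⊥-elim (q≉-1 (inverseʳ-unique 1# q (sym 0≈1+q)))
    ... | tri> _ _ 1+q<0 = λ [1+n]≈0 →
      0<x⇒x≉0 (1+q<0⇒0<[1+n]q²⁺ⁿ 1+q<0 n) (trans (*-congʳ [1+n]≈0) (zeroˡ _))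

    qfact-≉0 : q ≉ - 1# → ∀ n → qfact q n ≉ 0#
    qfact-≉0 q≉-1 zero    1≈0 = 0≉1 (sym 1≈0)
    qfact-≉0 q≉-1 (suc n) = *-≉0 (qfact-≉0 q≉-1 n) (qint-≉0 q≉-1 n)

    -- gauss i k is the Gaussian binomial coefficient [i + k choose k].
    gauss : ℕ → ℕ → Carrier
    gauss zero    k       = 1#
    gauss (suc i) zero    = 1#
    gauss (suc i) (suc k) = gauss (suc i) k + pow q (suc k) * gauss i (suc k)

    gauss-zeroʳ : ∀ i → gauss i 0 ≈ 1#
    gauss-zeroʳ zero    = refl
    gauss-zeroʳ (suc i) = refl

    gauss-pascal₁ : ∀ i k → gauss (suc i) k ≈ shift (gauss (suc i)) k + pow q k * gauss i k
    gauss-pascal₁ i zero    =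
      sym (trans (+-congˡ (*-congˡ (gauss-zeroʳ i))) (solve 0 (con 0 :+ con 1 :* con 1 := con 1) refl))
    gauss-pascal₁ i (suc k) = refl

    gauss-1 : ∀ k → gauss 1 k ≈ qint q (suc k)
    gauss-1 zero    = sym (+-identityˡ 1#)
    gauss-1 (suc k) = +-cong (gauss-1 k) (*-identityʳ _)

    gauss*qfact : ∀ i k → gauss i k * (qfact q k * qfact q i) ≈ qfact q (i ℕ.+ k)
    gauss*qfact zero    k       = trans (*-identityˡ _) (*-identityʳ _)
    gauss*qfact (suc i) zero    =
      trans (*-identityˡ _) (trans (*-identityˡ _) (reflexive (≡.cong (qfact q) (≡.sym (ℕ.+-identityʳ (suc i))))))
    gauss*qfact (suc i) (suc k) = begin
      (gauss (suc i) k + pow q (suc k) * gauss i (suc k)) * ((qfact q k * [1+k]) * (qfact q i * [1+i]))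
        ≈⟨ solve 7 (λ G₁ Q G₂ fk ik fi ii → (G₁ :+ Q :* G₂) :* ((fk :* ik) :* (fi :* ii))
                    := (G₁ :* (fk :* (fi :* ii))) :* ik :+ (Q :* ii) :* (G₂ :* ((fk :* ik) :* fi))) refl
                   (gauss (suc i) k) (pow q (suc k)) (gauss i (suc k)) (qfact q k) [1+k] (qfact q i) [1+i] ⟩
      (gauss (suc i) k * (qfact q k * qfact q (suc i))) * [1+k]
        + (pow q (suc k) * [1+i]) * (gauss i (suc k) * (qfact q (suc k) * qfact q i))
        ≈⟨ +-cong (*-congʳ (gauss*qfact (suc i) k))
                  (*-congˡ (trans (gauss*qfact i (suc k)) (reflexive (≡.cong (qfact q) (ℕ.+-suc i k))))) ⟩
      [1+i+k]! * [1+k] + (pow q (suc k) * [1+i]) * [1+i+k]!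
        ≈⟨ solve 4 (λ f a b c → f :* a :+ (b :* c) :* f := f :* (a :+ b :* c)) refl
                   [1+i+k]! [1+k] (pow q (suc k)) [1+i] ⟩
      [1+i+k]! * ([1+k] + pow q (suc k) * [1+i])
        ≈⟨ *-congˡ (sym (qint-+ (suc k) (suc i))) ⟩
      [1+i+k]! * qint q (suc k ℕ.+ suc i)
        ≈⟨ reflexive (≡.cong (λ n → [1+i+k]! * qint q n)
                             (≡.trans (ℕ.+-suc (suc k) i) (≡.cong (2 ℕ.+_) (ℕ.+-comm k i)))) ⟩
      qfact q (2 ℕ.+ (i ℕ.+ k))
        ≈⟨ reflexive (≡.cong (λ n → qfact q (suc n)) (≡.sym (ℕ.+-suc i k))) ⟩
      qfact q (suc i ℕ.+ suc k) ∎
      where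
        [1+i] [1+k] [1+i+k]! : Carrier
        [1+i] = qint q (suc i)
        [1+k] = qint q (suc k)
        [1+i+k]! = qfact q (suc (i ℕ.+ k))

    module _ (q≉-1 : q ≉ - 1#) where

      private
        [k]![i]!≉0 : ∀ i k → qfact q k * qfact q i ≉ 0#
        [k]![i]!≉0 i k = *-≉0 (qfact-≉0 q≉-1 k) (qfact-≉0 q≉-1 i)

      qbinom-gauss : ∀ i k → qbinom q (i ℕ.+ k) k ≈ gauss i k
      qbinom-gauss i k rewrite ℕ.m+n∸n≡m i k = begin
        qfact q (i ℕ.+ k) * d ⁻¹   ≈⟨ *-congʳ (gauss*qfact i k) ⟨
        (gauss i k * d) * d ⁻¹     ≈⟨ *-assoc _ _ _ ⟩
        gauss i k * (d * d ⁻¹)     ≈⟨ *-congˡ (⁻¹-inverse d ([k]![i]!≉0 i k)) ⟩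
        gauss i k * 1#             ≈⟨ *-identityʳ _ ⟩
        gauss i k                  ∎
        where
          d : Carrier
          d = qfact q k * qfact q i

      gauss-sym : ∀ i k → gauss i k ≈ gauss k i
      gauss-sym i k = *-cancelʳ-≉0 (qfact q k * qfact q i) _ _ ([k]![i]!≉0 i k) (begin
        gauss i k * (qfact q k * qfact q i)   ≈⟨ gauss*qfact i k ⟩
        qfact q (i ℕ.+ k)                     ≈⟨ reflexive (≡.cong (qfact q) (ℕ.+-comm i k)) ⟩
        qfact q (k ℕ.+ i)                     ≈⟨ gauss*qfact k i ⟨
        gauss k i * (qfact q i * qfact q k)   ≈⟨ *-congˡ (*-comm _ _) ⟩
        gauss k i * (qfact q k * qfact q i)   ∎)

      gauss-pascal₂ : ∀ i k → gauss (suc i) (suc k) ≈ gauss i (suc k) + pow q (suc i) * gauss (suc i) k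
      gauss-pascal₂ i k = trans (gauss-sym (suc i) (suc k))
                                (+-cong (gauss-sym (suc k) i) (*-congˡ (gauss-sym k (suc i))))

      -- For m ≥ 1, rewriting gauss (2+a) m by both Pascal rules and gauss (1+a) m by one of
      -- them on each side turns both sides into the same polynomial in gauss a m,
      -- gauss (1+a) (m-1) and gauss (2+a) (m-2).
      gauss-three-term : ∀ a m →
        pow q (suc a) * gauss (2 ℕ.+ a) m + gauss a m
          ≈ (1# + pow q (m ℕ.+ suc a)) * gauss (suc a) m
            + (pow q (suc a) * pow q (2 ℕ.+ a)) * shift (shift (gauss (2 ℕ.+ a))) m
      gauss-three-term a zero = trans (+-congˡ (gauss-zeroʳ a))
        (solve 2 (λ Q Q′ → Q :* con 1 :+ con 1 := (con 1 :+ Q) :* con 1 :+ (Q :* Q′) :* con 0)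
               refl (pow q (suc a)) (pow q (2 ℕ.+ a)))
      gauss-three-term a (suc m) = begin
        Q * gauss (2 ℕ.+ a) (suc m) + G₀
          ≈⟨ +-congʳ (*-congˡ (trans (gauss-pascal₂ (suc a) m)
                                     (+-congˡ (*-congˡ (gauss-pascal₁ (suc a) m))))) ⟩
        Q * ((G′ + (q * M) * G₀) + (q * Q) * (L + M * G′)) + G₀
          ≈⟨ solve 6 (λ q Q M G₀ G′ L → Q :* ((G′ :+ (q :* M) :* G₀) :+ (q :* Q) :* (L :+ M :* G′)) :+ G₀
                       := (con 1 :+ q :* (M :* Q)) :* (G₀ :+ Q :* G′) :+ (Q :* (q :* Q)) :* L)
                   refl q Q M G₀ G′ L ⟩
        (1# + q * (M * Q)) * (G₀ + Q * G′) + (Q * (q * Q)) * L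
          ≈⟨ +-congʳ (*-cong (+-congˡ (*-congˡ (sym (pow-+ q m (suc a))))) (sym (gauss-pascal₂ a m))) ⟩
        (1# + pow q (suc m ℕ.+ suc a)) * gauss (suc a) (suc m) + (Q * pow q (2 ℕ.+ a)) * L  ∎
        where
          Q M G₀ G′ L : Carrier
          Q  = pow q (suc a)
          M  = pow q m
          G₀ = gauss a (suc m)
          G′ = gauss (suc a) m
          L  = shift (gauss (2 ℕ.+ a)) m

  -- diagSum f n is the sum of f i k over all i, k with i + 2k = n.
  diagSum : (ℕ → ℕ → Carrier) → ℕ → Carrier
  diagSum f zero          = f 0 0
  diagSum f (suc zero)    = f 1 0
  diagSum f (suc (suc n)) = f (2 ℕ.+ n) 0 + diagSum (λ i k → f i (suc k)) n

  diagSum-cong : ∀ {f h} n → (∀ i k → i ℕ.+ 2 ℕ.* k ≡ n → f i k ≈ h i k) → diagSum f n ≈ diagSum h n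
  diagSum-cong zero          f≈h = f≈h 0 0 ≡.refl
  diagSum-cong (suc zero)    f≈h = f≈h 1 0 ≡.refl
  diagSum-cong (suc (suc n)) f≈h = +-cong (f≈h (2 ℕ.+ n) 0 (ℕ.+-identityʳ _))
    (diagSum-cong n (λ i k i+2k≡n →
      f≈h i (suc k) (≡.trans (m+2[1+n]≡2+[m+2n] i k) (≡.cong (2 ℕ.+_) i+2k≡n))))

  diagSum-+ : ∀ f h n → diagSum (λ i k → f i k + h i k) n ≈ diagSum f n + diagSum h n
  diagSum-+ f h zero          = refl
  diagSum-+ f h (suc zero)    = refl
  diagSum-+ f h (suc (suc n)) = trans (+-congˡ (diagSum-+ _ _ n))
    (solve 4 (λ a b c d → (a :+ b) :+ (c :+ d) := (a :+ c) :+ (b :+ d)) refl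
           (f (2 ℕ.+ n) 0) (h (2 ℕ.+ n) 0) (diagSum (λ i k → f i (suc k)) n) (diagSum (λ i k → h i (suc k)) n))

  diagSum-*ˡ : ∀ d f n → diagSum (λ i k → d * f i k) n ≈ d * diagSum f n
  diagSum-*ˡ d f zero          = refl
  diagSum-*ˡ d f (suc zero)    = refl
  diagSum-*ˡ d f (suc (suc n)) = trans (+-congˡ (diagSum-*ˡ d _ n)) (sym (distribˡ d _ _))

  diagSum-shiftᵢ : ∀ (c w : ℕ → ℕ → Carrier) n → diagSum (λ i k → shift (λ j → c j k) i * w i k) (suc n)
                           ≈ diagSum (λ i k → c i k * w (suc i) k) n
  diagSum-shiftᵢ c w zero          = refl
  diagSum-shiftᵢ c w (suc zero)    = trans (+-congˡ (zeroˡ _)) (+-identityʳ _)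
  diagSum-shiftᵢ c w (suc (suc n)) =
    +-congˡ (diagSum-shiftᵢ (λ i k → c i (suc k)) (λ i k → w i (suc k)) n)

  diagSum-shiftₖ : ∀ (c w : ℕ → ℕ → Carrier) n → diagSum (λ i k → shift (c i) k * w i k) (2 ℕ.+ n)
                           ≈ diagSum (λ i k → c i k * w i (suc k)) n
  diagSum-shiftₖ c w n = trans (+-congʳ (zeroˡ _)) (+-identityˡ _)

  sumTo-unfoldˡ : ∀ h m → sumTo h (suc m) ≈ h 0 + sumTo (λ k → h (suc k)) m
  sumTo-unfoldˡ h zero    = refl
  sumTo-unfoldˡ h (suc m) = trans (+-congʳ (sumTo-unfoldˡ h m)) (+-assoc _ _ _)

  diagSum-sumTo : ∀ {f h} n → (∀ i k → i ℕ.+ 2 ℕ.* k ≡ n → f i k ≈ h k) → diagSum f n ≈ sumTo h (n / 2)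
  diagSum-sumTo zero          f≈h = f≈h 0 0 ≡.refl
  diagSum-sumTo (suc zero)    f≈h = f≈h 1 0 ≡.refl
  diagSum-sumTo {f} {h} (suc (suc n)) f≈h = begin
    f (2 ℕ.+ n) 0 + diagSum (λ i k → f i (suc k)) n
      ≈⟨ +-cong (f≈h (2 ℕ.+ n) 0 (ℕ.+-identityʳ _))
                (diagSum-sumTo n (λ i k i+2k≡n → f≈h i (suc k)
                  (≡.trans (m+2[1+n]≡2+[m+2n] i k) (≡.cong (2 ℕ.+_) i+2k≡n)))) ⟩
    h 0 + sumTo (λ k → h (suc k)) (n / 2)   ≈⟨ sumTo-unfoldˡ h (n / 2) ⟨
    sumTo h (suc (n / 2))                   ≈⟨ reflexive (≡.cong (sumTo h) ([2+n]/2≡1+n/2 n)) ⟨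
    sumTo h ((2 ℕ.+ n) / 2)                 ∎

  recurrence-unique : ∀ (u v A B : ℕ → Carrier) → u 0 ≈ v 0 → u 1 ≈ v 1 →
    (∀ n → u (2 ℕ.+ n) ≈ A n * u (suc n) + B n * u n) →
    (∀ n → v (2 ℕ.+ n) ≈ A n * v (suc n) + B n * v n) →
    ∀ n → u n ≈ v n
  recurrence-unique u v A B u₀≈v₀ u₁≈v₁ recᵤ recᵥ n = proj₁ (consecutive n)
    where
      consecutive : ∀ n → u n ≈ v n × u (suc n) ≈ v (suc n)
      consecutive zero    = u₀≈v₀ , u₁≈v₁
      consecutive (suc n) with consecutive n
      ... | uₙ≈vₙ , uₙ₊₁≈vₙ₊₁ =
        uₙ₊₁≈vₙ₊₁ ,
        trans (recᵤ n) (trans (+-cong (*-congˡ uₙ₊₁≈vₙ₊₁) (*-congˡ uₙ≈vₙ)) (sym (recᵥ n)))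

  module _ (x s q : Carrier) where

    monomial : ℕ → ℕ → Carrier
    monomial i k = pow x i * P x s q k

    expansion : (ℕ → ℕ → Carrier) → ℕ → Carrier
    expansion c = diagSum (λ i k → c i k * monomial i k)

    monomial-step : ∀ {n} i k → i ℕ.+ 2 ℕ.* k ≡ n →
      (pow q (suc n) * s) * monomial i k + pow q i * monomial (2 ℕ.+ i) k ≈ pow q i * monomial i (suc k)
    monomial-step i k ≡.refl = begin
      (pow q (suc (i ℕ.+ 2 ℕ.* k)) * s) * (X * Pₖ) + Qᵢ * ((x * (x * X)) * Pₖ)
        ≈⟨ +-congʳ (*-congʳ (*-congʳ q¹⁺ⁱ⁺²ᵏ≈qⁱq¹⁺²ᵏ)) ⟩
      ((Qᵢ * Qₖ) * s) * (X * Pₖ) + Qᵢ * ((x * (x * X)) * Pₖ)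
        ≈⟨ solve 6 (λ Qᵢ Qₖ s X Pₖ x → ((Qᵢ :* Qₖ) :* s) :* (X :* Pₖ) :+ Qᵢ :* ((x :* (x :* X)) :* Pₖ)
                     := Qᵢ :* (X :* (Pₖ :* (x :* (x :* con 1) :+ Qₖ :* s))))
                   refl Qᵢ Qₖ s X Pₖ x ⟩
      Qᵢ * (X * (Pₖ * (x * (x * 1#) + Qₖ * s)))  ∎
      where
        Qᵢ Qₖ X Pₖ : Carrier
        Qᵢ = pow q i
        Qₖ = pow q (suc (2 ℕ.* k))
        X  = pow x i
        Pₖ = P x s q k
        q¹⁺ⁱ⁺²ᵏ≈qⁱq¹⁺²ᵏ : pow q (suc (i ℕ.+ 2 ℕ.* k)) ≈ Qᵢ * Qₖ
        q¹⁺ⁱ⁺²ᵏ≈qⁱq¹⁺²ᵏ =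
          trans (reflexive (≡.cong (pow q) (≡.sym (ℕ.+-suc i (2 ℕ.* k))))) (pow-+ q i _)

    -- The hypothesis compares the coefficients of xⁱ Pₖ on both sides of the recurrence,
    -- after q¹⁺ⁿ s xⁱ Pₖ has been rewritten as qⁱ (xⁱ Pₖ₊₁ - xⁱ⁺² Pₖ) by monomial-step.
    expansion-recurrence : ∀ (c : ℕ → ℕ → Carrier) α n →
      (∀ i k → i ℕ.+ 2 ℕ.* k ≡ 2 ℕ.+ n →
         c i k + shift (shift (λ j → pow q j * c j k)) i
           ≈ α * shift (λ j → c j k) i + shift (λ l → pow q i * c i l) k) →
      expansion c (2 ℕ.+ n) ≈ (α * x) * expansion c (suc n) + (pow q (suc n) * s) * expansion c n
    expansion-recurrence c α n coefficients = ∙-cancelʳ E _ _ (begin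
      expansion c (2 ℕ.+ n) + E
        ≈⟨ diagSum-+ (λ i k → c i k * monomial i k)
                     (λ i k → shift (shift (λ j → b j k)) i * monomial i k) (2 ℕ.+ n) ⟨
      diagSum (λ i k → c i k * monomial i k + shift (shift (λ j → b j k)) i * monomial i k) (2 ℕ.+ n)
        ≈⟨ diagSum-cong (2 ℕ.+ n) (λ i k i+2k≡2+n →
             trans (sym (distribʳ (monomial i k) _ _))
                   (trans (*-congʳ (coefficients i k i+2k≡2+n))
                          (trans (distribʳ (monomial i k) _ _) (+-congʳ (*-assoc α _ _))))) ⟩
      diagSum (λ i k → α * (shift (λ j → c j k) i * monomial i k) + shift (b i) k * monomial i k) (2 ℕ.+ n)
        ≈⟨ diagSum-+ (λ i k → α * (shift (λ j → c j k) i * monomial i k))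
                     (λ i k → shift (b i) k * monomial i k) (2 ℕ.+ n) ⟩
      diagSum (λ i k → α * (shift (λ j → c j k) i * monomial i k)) (2 ℕ.+ n)
        + diagSum (λ i k → shift (b i) k * monomial i k) (2 ℕ.+ n)
        ≈⟨ +-cong x-part (sym s-part) ⟩
      (α * x) * expansion c (suc n) + (β * expansion c n + E)
        ≈⟨ +-assoc _ _ _ ⟨
      ((α * x) * expansion c (suc n) + β * expansion c n) + E  ∎)
      where
        β : Carrier
        β = pow q (suc n) * s
        b : ℕ → ℕ → Carrier
        b i k = pow q i * c i k
        E : Carrier
        E = diagSum (λ i k → shift (shift (λ j → b j k)) i * monomial i k) (2 ℕ.+ n)

        x-part : diagSum (λ i k → α * (shift (λ j → c j k) i * monomial i k)) (2 ℕ.+ n)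
               ≈ (α * x) * expansion c (suc n)
        x-part = begin
          diagSum (λ i k → α * (shift (λ j → c j k) i * monomial i k)) (2 ℕ.+ n)
            ≈⟨ diagSum-*ˡ α (λ i k → shift (λ j → c j k) i * monomial i k) (2 ℕ.+ n) ⟩
          α * diagSum (λ i k → shift (λ j → c j k) i * monomial i k) (2 ℕ.+ n)
            ≈⟨ *-congˡ (diagSum-shiftᵢ c monomial (suc n)) ⟩
          α * diagSum (λ i k → c i k * monomial (suc i) k) (suc n)
            ≈⟨ *-congˡ (diagSum-cong {f = λ i k → c i k * monomial (suc i) k} (suc n) (λ i k _ →
                 solve 4 (λ c x X Pₖ → c :* ((x :* X) :* Pₖ) := x :* (c :* (X :* Pₖ))) refl
                         (c i k) x (pow x i) (P x s q k))) ⟩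
          α * diagSum (λ i k → x * (c i k * monomial i k)) (suc n)
            ≈⟨ *-congˡ (diagSum-*ˡ x (λ i k → c i k * monomial i k) (suc n)) ⟩
          α * (x * expansion c (suc n))
            ≈⟨ *-assoc _ _ _ ⟨
          (α * x) * expansion c (suc n)  ∎

        s-part : β * expansion c n + E ≈ diagSum (λ i k → shift (b i) k * monomial i k) (2 ℕ.+ n)
        s-part = begin
          β * expansion c n + E
            ≈⟨ +-cong (sym (diagSum-*ˡ β _ n))
                      (trans (diagSum-shiftᵢ _ monomial (suc n)) (diagSum-shiftᵢ b (λ i k → monomial (suc i) k) n)) ⟩
          diagSum (λ i k → β * (c i k * monomial i k)) n + diagSum (λ i k → b i k * monomial (2 ℕ.+ i) k) n
            ≈⟨ diagSum-+ (λ i k → β * (c i k * monomial i k)) (λ i k → b i k * monomial (2 ℕ.+ i) k) n ⟨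
          diagSum (λ i k → β * (c i k * monomial i k) + b i k * monomial (2 ℕ.+ i) k) n
            ≈⟨ diagSum-cong n (λ i k i+2k≡n → begin
                 β * (c i k * monomial i k) + (pow q i * c i k) * monomial (2 ℕ.+ i) k
                   ≈⟨ solve 5 (λ β c Q m m₂ → β :* (c :* m) :+ (Q :* c) :* m₂ := c :* (β :* m :+ Q :* m₂))
                              refl β (c i k) (pow q i) (monomial i k) (monomial (2 ℕ.+ i) k) ⟩
                 c i k * (β * monomial i k + pow q i * monomial (2 ℕ.+ i) k)
                   ≈⟨ *-congˡ (monomial-step i k i+2k≡n) ⟩
                 c i k * (pow q i * monomial i (suc k))
                   ≈⟨ solve 3 (λ c Q m → c :* (Q :* m) := (Q :* c) :* m) refl
                              (c i k) (pow q i) (monomial i (suc k)) ⟩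
                 (pow q i * c i k) * monomial i (suc k)  ∎) ⟩
          diagSum (λ i k → b i k * monomial i (suc k)) n
            ≈⟨ diagSum-shiftₖ b monomial n ⟨
          diagSum (λ i k → shift (b i) k * monomial i k) (2 ℕ.+ n)  ∎

    -- The coefficient of xⁱ Pₖ (i + 2k = n) in Tₙ for e = 0 and in Uₙ for e = 1.
    coefficient : ℕ → ℕ → ℕ → Carrier
    coefficient e i k = pow q (i C 2) * gauss q i (e ℕ.+ 2 ℕ.* k)

    module _ (q≉-1 : q ≉ - 1#) where

      coefficient-identity : ∀ {e} → e ℕ.≤ 1 → ∀ n i k → i ℕ.+ 2 ℕ.* k ≡ 2 ℕ.+ n →
        coefficient e i k + shift (shift (λ j → pow q j * coefficient e j k)) i
          ≈ (1# + pow q (e ℕ.+ suc n)) * shift (λ j → coefficient e j k) i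
            + shift (λ l → pow q i * coefficient e i l) k
      coefficient-identity _ n zero zero ()
      coefficient-identity {e} _ n zero (suc k) _ =
        solve 1 (λ α → con 1 :* con 1 :+ con 0 := α :* con 0 :+ con 1 :* (con 1 :* con 1)) refl
              (1# + pow q (e ℕ.+ suc n))
      coefficient-identity _ n (suc zero) zero ()
      coefficient-identity {e} _ n (suc zero) (suc k) 1+2[1+k]≡2+n = begin
        1# * gauss q 1 (e ℕ.+ 2 ℕ.* suc k) + 0#
          ≈⟨ trans (+-identityʳ _) (trans (*-identityˡ _)
                   (reflexive (≡.cong (gauss q 1) (m+2[1+n]≡2+[m+2n] e k)))) ⟩
        gauss q 1 (2 ℕ.+ m)
          ≈⟨ gauss-1 q (2 ℕ.+ m) ⟩
        qint q (3 ℕ.+ m)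
          ≈⟨ qint-suc q (2 ℕ.+ m) ⟩
        1# + q * (qint q (suc m) + pow q (suc m))
          ≈⟨ +-congˡ (*-congˡ (+-congʳ (sym (gauss-1 q m)))) ⟩
        1# + q * (gauss q 1 m + pow q (suc m))
          ≈⟨ solve 3 (λ q G Q → con 1 :+ q :* (G :+ Q)
                              := (con 1 :+ q :* Q) :* (con 1 :* con 1) :+ (q :* con 1) :* (con 1 :* G))
                   refl q (gauss q 1 m) (pow q (suc m)) ⟩
        (1# + pow q (2 ℕ.+ m)) * (1# * 1#) + (q * 1#) * (1# * gauss q 1 m)
          ≈⟨ +-congʳ (*-congʳ (+-congˡ (reflexive (≡.cong (pow q) e+1+n≡2+m)))) ⟨
        (1# + pow q (e ℕ.+ suc n)) * (1# * 1#) + (q * 1#) * (1# * gauss q 1 m)  ∎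
        where
          m : ℕ
          m = e ℕ.+ 2 ℕ.* k
          e+1+n≡2+m : e ℕ.+ suc n ≡ 2 ℕ.+ m
          e+1+n≡2+m =
            ≡.trans (≡.cong (e ℕ.+_) (≡.sym (ℕ.suc-injective 1+2[1+k]≡2+n))) (m+2[1+n]≡2+[m+2n] e k)
      coefficient-identity {e} e≤1 _ (suc (suc a)) k ≡.refl = begin
        pow q ((2 ℕ.+ a) C 2) * G₂ + pow q a * (pow q (a C 2) * G₀)
          ≈⟨ +-cong (*-congʳ (pow-[1+n]C2 q (suc a)))
                    (trans (solve 3 (λ Qₐ Cₐ G₀ → Qₐ :* (Cₐ :* G₀) := (Cₐ :* Qₐ) :* G₀) refl
                                    (pow q a) (pow q (a C 2)) G₀)
                           (*-congʳ (sym (pow-[1+n]C2 q a)))) ⟩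
        (Z * Q) * G₂ + Z * G₀
          ≈⟨ solve 4 (λ Z Q G₂ G₀ → (Z :* Q) :* G₂ :+ Z :* G₀ := Z :* (Q :* G₂ :+ G₀)) refl Z Q G₂ G₀ ⟩
        Z * (Q * G₂ + G₀)
          ≈⟨ *-congˡ (gauss-three-term q q≉-1 a m) ⟩
        Z * ((1# + pow q (m ℕ.+ suc a)) * G₁ + (Q * pow q (2 ℕ.+ a)) * L)
          ≈⟨ solve 6 (λ Z α G₁ Q Q₂ L → Z :* (α :* G₁ :+ (Q :* Q₂) :* L)
                                       := α :* (Z :* G₁) :+ Q₂ :* ((Z :* Q) :* L))
                   refl Z (1# + pow q (m ℕ.+ suc a)) G₁ Q (pow q (2 ℕ.+ a)) L ⟩
        (1# + pow q (m ℕ.+ suc a)) * (Z * G₁) + pow q (2 ℕ.+ a) * ((Z * Q) * L)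
          ≈⟨ +-cong (*-congʳ (+-congˡ (reflexive
                      (≡.cong (pow q) (≡.sym (m+[1+n+o]≡[m+o]+[1+n] e a (2 ℕ.* k)))))))
                    (sym (trans (shift-*ˡ (pow q (2 ℕ.+ a)) (coefficient e (2 ℕ.+ a)) k)
                                (*-congˡ (trans (shift-*ˡ (pow q ((2 ℕ.+ a) C 2)) _ k)
                                                (*-cong (pow-[1+n]C2 q (suc a))
                                                        (reflexive (shift-even e≤1 (gauss q (2 ℕ.+ a)) k))))))) ⟩
        (1# + pow q (e ℕ.+ suc (a ℕ.+ 2 ℕ.* k))) * (Z * G₁)
          + shift (λ l → pow q (2 ℕ.+ a) * coefficient e (2 ℕ.+ a) l) k  ∎
        where
          m : ℕ
          m = e ℕ.+ 2 ℕ.* k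
          Z Q G₀ G₁ G₂ L : Carrier
          Z  = pow q (suc a C 2)
          Q  = pow q (suc a)
          G₀ = gauss q a m
          G₁ = gauss q (suc a) m
          G₂ = gauss q (2 ℕ.+ a) m
          L  = shift (shift (gauss q (2 ℕ.+ a))) m

      expansion-coefficient-recurrence : ∀ {e} → e ℕ.≤ 1 → ∀ n →
        expansion (coefficient e) (2 ℕ.+ n)
          ≈ ((1# + pow q (e ℕ.+ suc n)) * x) * expansion (coefficient e) (suc n)
            + (pow q (suc n) * s) * expansion (coefficient e) n
      expansion-coefficient-recurrence {e} e≤1 n =
        expansion-recurrence (coefficient e) (1# + pow q (e ℕ.+ suc n)) n (coefficient-identity e≤1 n)

      T≈expansion : ∀ n → T x s q n ≈ expansion (coefficient 0) n
      T≈expansion = recurrence-unique (T x s q) (expansion (coefficient 0))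
        (λ n → (1# + pow q (suc n)) * x) (λ n → pow q (suc n) * s)
        (solve 0 (con 1 := (con 1 :* con 1) :* (con 1 :* con 1)) refl)
        (solve 1 (λ x → x := (con 1 :* con 1) :* ((x :* con 1) :* con 1)) refl x)
        (λ n → refl) (expansion-coefficient-recurrence z≤n)

      U≈expansion : ∀ n → U x s q n ≈ expansion (coefficient 1) n
      U≈expansion = recurrence-unique (U x s q) (expansion (coefficient 1))
        (λ n → (1# + pow q (2 ℕ.+ n)) * x) (λ n → pow q (suc n) * s)
        (solve 0 (con 1 := (con 1 :* con 1) :* (con 1 :* con 1)) refl)
        (solve 3 (λ q x s → ((con 1 :+ q :* con 1) :* x) :* con 1 :+ (con 1 :* s) :* con 0
                          := (con 1 :* (con 1 :+ (q :* con 1) :* con 1)) :* ((x :* con 1) :* con 1))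
               refl q x s)
        (λ n → refl) (expansion-coefficient-recurrence (s≤s z≤n))

      coefficient-monomial : ∀ e {n N} i k → i ℕ.+ 2 ℕ.* k ≡ n → i ℕ.+ (e ℕ.+ 2 ℕ.* k) ≡ N →
        coefficient e i k * monomial i k
          ≈ pow q ((n ∸ 2 ℕ.* k) C 2) * qbinom q N (e ℕ.+ 2 ℕ.* k) * pow x (n ∸ 2 ℕ.* k) * P x s q k
      coefficient-monomial e i k ≡.refl ≡.refl rewrite ℕ.m+n∸n≡m i (2 ℕ.* k) =
        trans (sym (*-assoc _ _ _)) (*-congʳ (*-congʳ (*-congˡ (sym (qbinom-gauss q q≉-1 i (e ℕ.+ 2 ℕ.* k))))))

      expansion≈T-rhs : ∀ n → expansion (coefficient 0) n ≈ T-rhs x s q n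
      expansion≈T-rhs n = diagSum-sumTo n (λ i k i+2k≡n → coefficient-monomial 0 i k i+2k≡n i+2k≡n)

      expansion≈U-rhs : ∀ n → expansion (coefficient 1) n ≈ U-rhs x s q n
      expansion≈U-rhs n = diagSum-sumTo n (λ i k i+2k≡n →
        coefficient-monomial 1 i k i+2k≡n (≡.trans (ℕ.+-suc i (2 ℕ.* k)) (≡.cong suc i+2k≡n)))

theorem2p7 : ∀ {c ℓ₁ ℓ₂ : Level} (F : OrderedField c ℓ₁ ℓ₂) →
    let open OrderedField F in
    let open QDefs F in
    (x s q : Carrier) → ¬ (q ≈ - 1#) → (n : ℕ) →
      (T x s q n ≈ T-rhs x s q n) × (U x s q n ≈ U-rhs x s q n)
theorem2p7 F x s q q≉-1 n =
  trans (T≈expansion F x s q q≉-1 n) (expansion≈T-rhs F x s q q≉-1 n) ,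
  trans (U≈expansion F x s q q≉-1 n) (expansion≈U-rhs F x s q q≉-1 n)
  where open OrderedField F using (trans)
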